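{- Let $m=2r$ and $n=2s$ for some positive integers $r,s$. Then $\gamma_I(C_m \square C_n) = \frac{mn}{2}$.
   Context: For an integer $k\ge 2$, $C_k$ denotes the directed cycle with vertex set $\{1,2,\dots,k\}$ and arcs $i\rightarrow i+1$ (indices taken modulo $k$). For digraphs $D_1=(V_1,A_1)$ and $D_2=(V_2,A_2)$, the cartesian product $D_1\square D_2$ is the digraph with vertex set $V_1\times V_2$ in which $(x_1,x_2)\rightarrow(y_1,y_2)$ is an arc if and only if either ($x_1=y_1$ and $x_2\rightarrow y_2$ in $D_2$) or ($x_1\rightarrow y_1$ in $D_1$ and $x_2=y_2$). An Italian dominating function on a digraph $D$ is a function $f:V(D)\to\{0,1,2\}$ such that every vertex $v$ with $f(v)=0$ has at least two in-neighbors $u$ with $f(u)=1$ or at least one in-neighbor $w$ with $f(w)=2$ (an in-neighbor of $v$ is a vertex $u$ with $u\rightarrow v$). Its weight is $\sum_{u\in V(D)} f(u)$, and the Italian domination number $\gamma_I(D)$ is the minimum weight of an Italian dominating function on $D$. -}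

module Defs where

open import Data.Nat using (ℕ; zero; suc; _+_; _*_; _≤_)
open import Data.Fin using (Fin; toℕ; remQuot)
open import Data.List using (tabulate)
open import Data.Nat.ListAction using (sum)
open import Data.Product using (_×_; _,_; proj₁; proj₂; ∃-syntax)
open import Data.Sum using (_⊎_)
open import Data.Empty using (⊥)
open import Relation.Binary.PropositionalEquality using (_≡_)

-- A finite digraph whose vertex set is Fin order; (arc u v) means u → v.
record Digraph : Set₁ where
  field
    order : ℕ
    arc   : Fin order → Fin order → Set
open Digraph public

-- Directed cycle C_k; vertex i : Fin k stands for i+1 ∈ {1,…,k}.
-- Arc i → j iff j = i + 1 (mod k), i.e. j = i+1, or i is the last vertex and j the first.
Cycle : ℕ → Digraph
Cycle k = record
  { order = k
  ; arc   = λ i j → (toℕ j ≡ suc (toℕ i)) ⊎ ((suc (toℕ i) ≡ k) × (toℕ j ≡ 0))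
  }

-- Cartesian product D₁ □ D₂; vertex set Fin (n₁ * n₂) ≅ Fin n₁ × Fin n₂ via remQuot.
_□_ : Digraph → Digraph → Digraph
D₁ □ D₂ = record
  { order = order D₁ * order D₂
  ; arc   = λ x y → parc (remQuot (order D₂) x) (remQuot (order D₂) y)
  }
  where
    parc : Fin (order D₁) × Fin (order D₂) → Fin (order D₁) × Fin (order D₂) → Set
    parc (x₁ , x₂) (y₁ , y₂) =
      ((x₁ ≡ y₁) × arc D₂ x₂ y₂) ⊎ (arc D₁ x₁ y₁ × (x₂ ≡ y₂))

IsItalianDF : (D : Digraph) → (Fin (order D) → Fin 3) → Set
IsItalianDF D f = ∀ v → toℕ (f v) ≡ 0 →
    (∃[ u ] ∃[ w ] ((u ≡ w → ⊥) × arc D u v × arc D w v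
                     × toℕ (f u) ≡ 1 × toℕ (f w) ≡ 1))
  ⊎ (∃[ w ] (arc D w v × toℕ (f w) ≡ 2))

weight : (D : Digraph) → (Fin (order D) → Fin 3) → ℕ
weight D f = sum (tabulate (λ v → toℕ (f v)))

ItalianDominationNumber : Digraph → ℕ → Set
ItalianDominationNumber D k =
  (∃[ f ] (IsItalianDF D f × weight D f ≡ k))
  × (∀ f → IsItalianDF D f → k ≤ weight D f)

-- Every vertex of C_m □ C_n has exactly two in-neighbours, its predecessors along the row
-- and along the column, and both predecessor maps are permutations of the vertex set.
-- An Italian dominating function f satisfies 2 f(v) + f(ℓ v) + f(r v) ≥ 2 at every vertex v;
-- summed over v every value is counted four times, so 4 w(f) ≥ 2mn.  When m and n are even
-- the checkerboard function (1 on the cells with i + j even) has weight mn/2, and every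
-- 0-cell has both of its in-neighbours at 1.
module Submission where

open import Defs
open import Data.Empty using (⊥-elim)
open import Data.Fin using (Fin; zero; suc; toℕ; fromℕ; inject₁; combine; remQuot)
open import Data.Fin.Permutation using (Permutation′; permutation; _⟨$⟩ʳ_)
open import Data.Fin.Properties using (*↔×; toℕ-fromℕ; toℕ-inject₁; toℕ-injective; remQuot-combine; combine-remQuot; combine-injectiveˡ)
open import Data.Fin.Relation.Unary.Top using (View; view; ‵fromℕ; ‵inj₁; ‵inject₁; view-fromℕ; view-inject₁)
open import Data.List using (tabulate)
import Data.Nat.ListAction as List
open import Data.Nat using (ℕ; zero; suc; _+_; _*_; _/_; _≤_; z≤n; s≤s; parity)
open import Data.Nat.DivMod using (m*n/n≡m)
open import Data.Nat.Properties using (+-0-commutativeMonoid; +-comm; +-identityʳ; +-mono-≤; *-identityʳ; *-assoc; *-comm; *-cancelˡ-≤; *-cancelˡ-≡; ≤-reflexive; ≤-trans; m≤m+n; m≤n+m; suc-injective; module ≤-Reasoning)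
open import Algebra.Properties.CommutativeMonoid.Sum +-0-commutativeMonoid using (sum; ∑-distrib-+; sum-cong-≗; sum-permute)
open import Data.Parity.Base as ℙ using (Parity; 0ℙ; 1ℙ; _⁻¹)
open import Data.Parity.Properties using (suc-homo-⁻¹; *-homo-*; p≢p⁻¹)
open import Data.Product using (_×_; _,_; proj₁; proj₂; uncurry)
open import Data.Product.Function.NonDependent.Propositional using (_×-↔_)
open import Data.Sum using (_⊎_; inj₁; inj₂)
open import Function using (_∘_)
open import Function.Properties.Inverse using (↔-trans; ↔-sym; ↔-refl)
open import Relation.Binary.PropositionalEquality using (_≡_; _≢_; refl; sym; trans; cong; cong₂; subst; module ≡-Reasoning)

sumₗ-tabulate : ∀ {n} (g : Fin n → ℕ) → List.sum (tabulate g) ≡ sum g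
sumₗ-tabulate {zero}  g = refl
sumₗ-tabulate {suc n} g = cong (g zero +_) (sumₗ-tabulate (g ∘ suc))

weight≡sum : ∀ D (f : Fin (order D) → Fin 3) → weight D f ≡ sum (toℕ ∘ f)
weight≡sum D f = sumₗ-tabulate (toℕ ∘ f)

m+m≡2*m : ∀ m → m + m ≡ 2 * m
m+m≡2*m m = cong (m +_) (sym (+-identityʳ m))

sum-const : ∀ n c → sum {n} (λ _ → c) ≡ n * c
sum-const zero    c = refl
sum-const (suc n) c = cong (c +_) (sum-const n c)

sum-mono-≤ : ∀ {n} {g h : Fin n → ℕ} → (∀ i → g i ≤ h i) → sum g ≤ sum h
sum-mono-≤ {zero}  g≤h = z≤n
sum-mono-≤ {suc n} g≤h = +-mono-≤ (g≤h zero) (sum-mono-≤ (g≤h ∘ suc))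

sum-reindex : ∀ {n} (π : Permutation′ n) (g : Fin n → ℕ) → sum (g ∘ (π ⟨$⟩ʳ_)) ≡ sum g
sum-reindex π g = sym (sum-permute g π)

record InNeighbourPermutations (D : Digraph) : Set where
  field
    left right : Permutation′ (order D)
    arc-left   : ∀ v → arc D (left ⟨$⟩ʳ v) v
    arc-right  : ∀ v → arc D (right ⟨$⟩ʳ v) v
    arc⇒       : ∀ {u v} → arc D u v → u ≡ left ⟨$⟩ʳ v ⊎ u ≡ right ⟨$⟩ʳ v

module _ {D : Digraph} (N : InNeighbourPermutations D) where
  open InNeighbourPermutations N

  private
    V = Fin (order D)

    ℓ r : V → V
    ℓ = left ⟨$⟩ʳ_
    r = right ⟨$⟩ʳ_

  in-neighbour-≤ : (g : V → ℕ) → ∀ {w v} → arc D w v → g w ≤ g (ℓ v) + g (r v)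
  in-neighbour-≤ g w→v with arc⇒ w→v
  ... | inj₁ refl = m≤m+n _ _
  ... | inj₂ refl = m≤n+m _ _

  distinct-in-neighbours : (g : V → ℕ) → ∀ {u w v} → u ≢ w → arc D u v → arc D w v →
                           g u + g w ≡ g (ℓ v) + g (r v)
  distinct-in-neighbours g {u} {w} u≢w u→v w→v with arc⇒ u→v | arc⇒ w→v
  ... | inj₁ refl | inj₂ refl = refl
  ... | inj₂ refl | inj₁ refl = +-comm (g (r _)) (g (ℓ _))
  ... | inj₁ refl | inj₁ refl = ⊥-elim (u≢w refl)
  ... | inj₂ refl | inj₂ refl = ⊥-elim (u≢w refl)

  idf-local-bound : ∀ {f} → IsItalianDF D f → ∀ v →
                    let F = toℕ ∘ f in 2 ≤ (F v + F v) + (F (ℓ v) + F (r v))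
  idf-local-bound {f} idf v with toℕ (f v) in fv≡0
  ... | suc k = ≤-trans (+-mono-≤ (s≤s z≤n) (s≤s z≤n)) (m≤m+n (suc k + suc k) _)
  ... | zero with idf v fv≡0
  ...   | inj₁ (u , w , u≢w , u→v , w→v , fu≡1 , fw≡1) =
          ≤-reflexive (trans (sym (cong₂ _+_ fu≡1 fw≡1)) (distinct-in-neighbours (toℕ ∘ f) u≢w u→v w→v))
  ...   | inj₂ (w , w→v , fw≡2) = subst (_≤ _) fw≡2 (in-neighbour-≤ (toℕ ∘ f) w→v)

  idf-weight-bound : ∀ {f} → IsItalianDF D f → order D ≤ 2 * weight D f
  idf-weight-bound {f} idf = *-cancelˡ-≤ 2 (begin
    2 * order D                                   ≡⟨ *-comm 2 (order D) ⟩
    order D * 2                                   ≡⟨ sum-const (order D) 2 ⟨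
    sum {order D} (λ _ → 2)                       ≤⟨ sum-mono-≤ (idf-local-bound idf) ⟩
    sum (λ v → (F v + F v) + (F (ℓ v) + F (r v))) ≡⟨ ∑-distrib-+ (λ v → F v + F v) (λ v → F (ℓ v) + F (r v)) ⟩
    sum (λ v → F v + F v) + sum (λ v → F (ℓ v) + F (r v))
                                                  ≡⟨ cong₂ _+_ (∑-distrib-+ F F) (∑-distrib-+ (F ∘ ℓ) (F ∘ r)) ⟩
    (sum F + sum F) + (sum (F ∘ ℓ) + sum (F ∘ r)) ≡⟨ cong₂ (λ x y → (sum F + sum F) + (x + y)) (sum-reindex left F) (sum-reindex right F) ⟩
    (sum F + sum F) + (sum F + sum F)             ≡⟨ trans (m+m≡2*m (sum F + sum F)) (cong (2 *_) (m+m≡2*m (sum F))) ⟩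
    2 * (2 * sum F)                               ≡⟨ cong (λ w → 2 * (2 * w)) (weight≡sum D f) ⟨
    2 * (2 * weight D f)                          ∎)
    where
    open ≤-Reasoning
    F = toℕ ∘ f

  Alternating : (V → Fin 3) → Set
  Alternating g = ∀ v → toℕ (g v) + toℕ (g (ℓ v)) ≡ 1 × toℕ (g v) + toℕ (g (r v)) ≡ 1

  alternating-idf : ∀ {g} → Alternating g → (∀ v → ℓ v ≢ r v) → IsItalianDF D g
  alternating-idf {g} alt ℓ≢r v gv≡0 =
    inj₁ (ℓ v , r v , ℓ≢r v , arc-left v , arc-right v , complement (proj₁ (alt v)) , complement (proj₂ (alt v)))
    where
    complement : ∀ {x} → toℕ (g v) + x ≡ 1 → x ≡ 1
    complement {x} = subst (λ a → a + x ≡ 1) gv≡0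

  alternating-weight : ∀ {g} → Alternating g → 2 * weight D g ≡ order D
  alternating-weight {g} alt = begin
    2 * weight D g              ≡⟨ cong (2 *_) (weight≡sum D g) ⟩
    2 * sum G                   ≡⟨ m+m≡2*m (sum G) ⟨
    sum G + sum G               ≡⟨ cong (sum G +_) (sum-reindex left G) ⟨
    sum G + sum (G ∘ ℓ)         ≡⟨ ∑-distrib-+ G (G ∘ ℓ) ⟨
    sum (λ v → G v + G (ℓ v))   ≡⟨ sum-cong-≗ (proj₁ ∘ alt) ⟩
    sum {order D} (λ _ → 1)     ≡⟨ sum-const (order D) 1 ⟩
    order D * 1                 ≡⟨ *-identityʳ (order D) ⟩
    order D                     ∎
    where
    open ≡-Reasoning
    G = toℕ ∘ g

  italianDominationNumber-alternating : ∀ g → Alternating g → (∀ v → ℓ v ≢ r v) →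
                                        ∀ {k} → order D ≡ 2 * k → ItalianDominationNumber D k
  italianDominationNumber-alternating g alt ℓ≢r {k} order≡2k =
    (g , alternating-idf alt ℓ≢r , *-cancelˡ-≡ (weight D g) k 2 (trans (alternating-weight alt) order≡2k))
    , λ f idf → *-cancelˡ-≤ 2 (subst (_≤ 2 * weight D f) order≡2k (idf-weight-bound idf))

prev : ∀ {k} → Fin (suc k) → Fin (suc k)
prev {k} zero = fromℕ k
prev (suc i)  = inject₁ i

next-view : ∀ {k} {i : Fin (suc k)} → View i → Fin (suc k)
next-view ‵fromℕ       = zero
next-view (‵inject₁ j) = suc j

next : ∀ {k} → Fin (suc k) → Fin (suc k)
next i = next-view (view i)

next-prev : ∀ {k} (i : Fin (suc k)) → next (prev i) ≡ i
next-prev {k} zero rewrite view-fromℕ k = refl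
next-prev (suc i) rewrite view-inject₁ i = refl

prev-next-view : ∀ {k} {i : Fin (suc k)} (v : View i) → prev (next-view v) ≡ i
prev-next-view ‵fromℕ    = refl
prev-next-view (‵inj₁ _) = refl

prev-next : ∀ {k} (i : Fin (suc k)) → prev (next i) ≡ i
prev-next i = prev-next-view (view i)

rotation : ∀ k → Permutation′ (suc k)
rotation k = permutation prev next prev-next next-prev

cycle-arc⇒prev : ∀ {k} {u v : Fin (suc k)} → arc (Cycle (suc k)) u v → u ≡ prev v
cycle-arc⇒prev {v = suc v} (inj₁ v≡1+u) = toℕ-injective (trans (suc-injective (sym v≡1+u)) (sym (toℕ-inject₁ v)))
cycle-arc⇒prev {k} {v = zero} (inj₂ (1+u≡1+k , _)) = toℕ-injective (trans (suc-injective 1+u≡1+k) (sym (toℕ-fromℕ k)))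

prev-cycle-arc : ∀ {k} (v : Fin (suc k)) → arc (Cycle (suc k)) (prev v) v
prev-cycle-arc {k} zero = inj₂ (cong suc (toℕ-fromℕ k) , refl)
prev-cycle-arc (suc v)  = inj₁ (cong suc (sym (toℕ-inject₁ v)))

-- Only the wrap-around step from 0 to k needs suc k to be even.
parity-prev : ∀ {k} → parity (suc k) ≡ 0ℙ → (i : Fin (suc k)) → parity (toℕ (prev i)) ≡ parity (toℕ i) ⁻¹
parity-prev {k} even zero rewrite toℕ-fromℕ k = trans (sym (suc-homo-⁻¹ k)) (cong _⁻¹ even)
parity-prev even (suc i) rewrite toℕ-inject₁ i = sym (suc-homo-⁻¹ (toℕ i))

prev≢id : ∀ {k} → parity (suc k) ≡ 0ℙ → (i : Fin (suc k)) → prev i ≢ i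
prev≢id even i prev-i≡i = p≢p⁻¹ (parity (toℕ i)) (trans (cong (parity ∘ toℕ) (sym prev-i≡i)) (parity-prev even i))

evenIndicator : Parity → Fin 3
evenIndicator 0ℙ = suc zero
evenIndicator 1ℙ = zero

evenIndicator-flipˡ : ∀ p q → toℕ (evenIndicator (p ℙ.+ q)) + toℕ (evenIndicator (p ⁻¹ ℙ.+ q)) ≡ 1
evenIndicator-flipˡ 0ℙ 0ℙ = refl
evenIndicator-flipˡ 0ℙ 1ℙ = refl
evenIndicator-flipˡ 1ℙ 0ℙ = refl
evenIndicator-flipˡ 1ℙ 1ℙ = refl

evenIndicator-flipʳ : ∀ p q → toℕ (evenIndicator (p ℙ.+ q)) + toℕ (evenIndicator (p ℙ.+ q ⁻¹)) ≡ 1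
evenIndicator-flipʳ 0ℙ 0ℙ = refl
evenIndicator-flipʳ 0ℙ 1ℙ = refl
evenIndicator-flipʳ 1ℙ 0ℙ = refl
evenIndicator-flipʳ 1ℙ 1ℙ = refl

module Torus (m n : ℕ) where

  T : Digraph
  T = Cycle (suc m) □ Cycle (suc n)

  Cell : Set
  Cell = Fin (suc m) × Fin (suc n)

  cell : Fin (order T) → Cell
  cell = remQuot {suc m} (suc n)

  -- arc T u v unfolds definitionally to CellArc (cell u) (cell v).
  CellArc : Cell → Cell → Set
  CellArc (i , j) (i′ , j′) = (i ≡ i′ × arc (Cycle (suc n)) j j′) ⊎ (arc (Cycle (suc m)) i i′ × j ≡ j′)

  -- left and right send the vertex of cell (i , j) to the vertex of (prev i , j) and (i , prev j).
  left right : Permutation′ (order T)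
  left  = ↔-trans (*↔× {suc m} {suc n}) (↔-trans (rotation m ×-↔ ↔-refl) (↔-sym *↔×))
  right = ↔-trans (*↔× {suc m} {suc n}) (↔-trans (↔-refl ×-↔ rotation n) (↔-sym *↔×))

  cell-combine : ∀ i j → cell (combine i j) ≡ (i , j)
  cell-combine = remQuot-combine

  combine-cell : ∀ v → uncurry combine (cell v) ≡ v
  combine-cell = combine-remQuot {suc m} (suc n)

  arc-from-cell : ∀ {c} v → CellArc c (cell v) → arc T (uncurry combine c) v
  arc-from-cell {c} v = subst (λ c′ → CellArc c′ (cell v)) (sym (cell-combine (proj₁ c) (proj₂ c)))

  torus-in-neighbours : InNeighbourPermutations T
  torus-in-neighbours = record
    { left      = left
    ; right     = right
    ; arc-left  = λ v → arc-from-cell v (inj₂ (prev-cycle-arc (proj₁ (cell v)) , refl))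
    ; arc-right = λ v → arc-from-cell v (inj₁ (refl , prev-cycle-arc (proj₂ (cell v))))
    ; arc⇒      = λ {u} {v} → into {u} {v}
    }
    where
    into : ∀ {u v} → arc T u v → u ≡ left ⟨$⟩ʳ v ⊎ u ≡ right ⟨$⟩ʳ v
    into {u} (inj₁ (i≡i′ , j→j′)) = inj₂ (trans (sym (combine-cell u)) (cong₂ combine i≡i′ (cycle-arc⇒prev j→j′)))
    into {u} (inj₂ (i→i′ , j≡j′)) = inj₁ (trans (sym (combine-cell u)) (cong₂ combine (cycle-arc⇒prev i→i′) j≡j′))

  colour : Cell → Parity
  colour (i , j) = parity (toℕ i) ℙ.+ parity (toℕ j)

  checkerboard : Fin (order T) → Fin 3
  checkerboard v = evenIndicator (colour (cell v))

  module _ (rows-even : parity (suc m) ≡ 0ℙ) (cols-even : parity (suc n) ≡ 0ℙ) where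

    checkerboard-alternating : Alternating torus-in-neighbours checkerboard
    checkerboard-alternating v =
        subst (λ c → toℕ (checkerboard v) + toℕ (evenIndicator c) ≡ 1) (sym colour-left) (evenIndicator-flipˡ pᵢ pⱼ)
      , subst (λ c → toℕ (checkerboard v) + toℕ (evenIndicator c) ≡ 1) (sym colour-right) (evenIndicator-flipʳ pᵢ pⱼ)
      where
      i = proj₁ (cell v)
      j = proj₂ (cell v)
      pᵢ = parity (toℕ i)
      pⱼ = parity (toℕ j)
      colour-left : colour (cell (left ⟨$⟩ʳ v)) ≡ pᵢ ⁻¹ ℙ.+ pⱼ
      colour-left = trans (cong colour (cell-combine (prev i) j)) (cong (ℙ._+ pⱼ) (parity-prev rows-even i))
      colour-right : colour (cell (right ⟨$⟩ʳ v)) ≡ pᵢ ℙ.+ pⱼ ⁻¹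
      colour-right = trans (cong colour (cell-combine i (prev j))) (cong (pᵢ ℙ.+_) (parity-prev cols-even j))

    left≢right : ∀ v → left ⟨$⟩ʳ v ≢ right ⟨$⟩ʳ v
    left≢right v e = prev≢id rows-even (proj₁ (cell v)) (combine-injectiveˡ _ _ _ _ e)

    italianDominationNumber-torus : ∀ {k} → order T ≡ 2 * k → ItalianDominationNumber T k
    italianDominationNumber-torus =
      italianDominationNumber-alternating torus-in-neighbours checkerboard checkerboard-alternating left≢right

even-double : ∀ k → parity (2 * k) ≡ 0ℙ
even-double k = *-homo-* 2 k

theorem2p1 : ∀ (r s : ℕ) →
    ItalianDominationNumber (Cycle (2 * suc r) □ Cycle (2 * suc s))
      (((2 * suc r) * (2 * suc s)) / 2)
theorem2p1 r s =
  subst (ItalianDominationNumber _) (sym half≡k)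
    (Torus.italianDominationNumber-torus _ _ (even-double (suc r)) (even-double (suc s)) order≡2k)
  where
  k = suc r * (2 * suc s)
  order≡2k : (2 * suc r) * (2 * suc s) ≡ 2 * k
  order≡2k = *-assoc 2 (suc r) (2 * suc s)
  half≡k : (2 * suc r) * (2 * suc s) / 2 ≡ k
  half≡k = trans (cong (_/ 2) (trans order≡2k (*-comm 2 k))) (m*n/n≡m k 2)
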